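{- Let $G$ be a planar PCC graph and let $\sigma$ be a face of $G$ such that the multiset $V(\sigma)$ of vertices on the boundary walk of $\sigma$ is not a set (i.e. some vertex occurs more than once). Then $7\le|\sigma|\le 11$. The same conclusion holds if the multiset $E(\sigma)$ of edges on the boundary walk of $\sigma$ is not a set.
   Context: All graphs are finite, simple, connected, and 2-cell embedded in the sphere; the set of faces includes the outer face. For a face $\sigma$, $V(\sigma)$ and $E(\sigma)$ are the multisets of vertices and edges traversed by its boundary walk, and $|\sigma|$ is the cardinality of $E(\sigma)$. For a vertex $v$, $F(v)$ is the multiset of faces incident to $v$ (one entry per corner), $K(v)=1-\frac{\deg(v)}{2}+\sum_{\sigma\in F(v)}\frac{1}{|\sigma|}$, and the face vector $f(v)$ is the multiset of sizes of faces in $F(v)$. A prism of order $N$: $2N$ vertices, two faces of size $N$, $N$ faces of size $4$, $f(v)=\{4,4,N\}$ for all $v$. An antiprism of order $N$: $2N$ vertices, two faces of size $N$, $2N$ faces of size $3$, $f(v)=\{3,3,3,N\}$ for all $v$. A planar PCC graph is such a graph with $K(v)>0$ and $\deg(v)\ge3$ for every vertex $v$, which is not a prism or an antiprism. -}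

module Defs where

open import Data.Nat as ℕ using (ℕ; zero; suc; _≤ᵇ_; _≤_)
open import Data.Integer using (+_)
open import Data.Fin using (Fin; toℕ; _≟_)
open import Data.Bool using (Bool; true; false; not)
open import Data.List using (List; []; _∷_; map; length; upTo; allFin; filterᵇ; replicate; foldr)
open import Data.Bool.ListAction using (all; any)
open import Data.List.Relation.Binary.Permutation.Propositional using (_↭_)
open import Data.Rational as ℚ using (ℚ; 0ℚ; 1ℚ; _/_)
open import Data.Product using (Σ; ∃; ∃-syntax; _×_; _,_)
open import Data.Sum using (_⊎_)
open import Relation.Binary.PropositionalEquality using (_≡_; _≢_)
open import Relation.Nullary.Decidable using (⌊_⌋)
open import Data.Bool using (T)

-- A connected graph 2-cell
-- embedded in an orientable surface is encoded by its set of darts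
-- (half-edges) Fin n, the fixed-point-free involution α pairing the two
-- darts of each edge, and the permutation rot giving the cyclic order of
-- darts around their common tail vertex.  Vertices are rot-orbits, edges
-- are α-orbits, faces are orbits of φ = rot ∘ α.  Each dart in a face
-- orbit is one step of the boundary walk (one entry of E(σ)), whose tail
-- vertex is one entry of V(σ); the darts at a vertex v correspond
-- bijectively to the corners at v, the corner of dart e lying in the face
-- of e.

record Map : Set where
  field
    n      : ℕ
    α      : Fin n → Fin n
    rot    : Fin n → Fin n
    rot⁻¹  : Fin n → Fin n
    α-invol   : ∀ d → α (α d) ≡ d
    α-nofix   : ∀ d → α d ≢ d
    rot-inv₁  : ∀ d → rot (rot⁻¹ d) ≡ d
    rot-inv₂  : ∀ d → rot⁻¹ (rot d) ≡ d

module _ (M : Map) where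
  open Map M

  φ : Fin n → Fin n
  φ d = rot (α d)

  iter : (Fin n → Fin n) → ℕ → Fin n → Fin n
  iter p zero    d = d
  iter p (suc k) d = p (iter p k d)

  orbit : (Fin n → Fin n) → Fin n → List (Fin n)
  orbit p d = map (λ k → iter p k d) (upTo n)

  inOrbit : (Fin n → Fin n) → Fin n → Fin n → Bool
  inOrbit p d e = any (λ x → ⌊ x ≟ e ⌋) (orbit p d)

  orbitSet : (Fin n → Fin n) → Fin n → List (Fin n)
  orbitSet p d = filterᵇ (inOrbit p d) (allFin n)

  orbitSize : (Fin n → Fin n) → Fin n → ℕ
  orbitSize p d = length (orbitSet p d)

  isRep : (Fin n → Fin n) → Fin n → Bool
  isRep p d = all (λ e → toℕ d ≤ᵇ toℕ e) (orbit p d)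

  reps : (Fin n → Fin n) → List (Fin n)
  reps p = filterᵇ (isRep p) (allFin n)

  numVertices numEdges numFaces : ℕ
  numVertices = length (reps rot)
  numEdges    = length (reps α)
  numFaces    = length (reps φ)

  deg : Fin n → ℕ
  deg d = orbitSize rot d

  faceSize : Fin n → ℕ
  faceSize d = orbitSize φ d

  faceVector : Fin n → List ℕ
  faceVector d = map faceSize (orbitSet rot d)

  faceSizes : List ℕ
  faceSizes = map faceSize (reps φ)

  -- 1/k as a rational (k is always ≥ 1 for face sizes)
  recip : ℕ → ℚ
  recip zero    = 0ℚ
  recip (suc k) = + 1 / suc k

  curvature : Fin n → ℚ
  curvature d = (1ℚ ℚ.- (+ deg d / 2)) ℚ.+ foldr ℚ._+_ 0ℚ (map recip (faceVector d))

  data Reach (d : Fin n) : Fin n → Set where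
    here  : Reach d d
    stepα : ∀ {e} → Reach d e → Reach d (α e)
    stepρ : ∀ {e} → Reach d e → Reach d (rot e)

  Connected : Set
  Connected = ∀ d e → Reach d e

  NoLoops : Set
  NoLoops = ∀ d → T (not (inOrbit rot d (α d)))

  NoMultiEdges : Set
  NoMultiEdges = ∀ d e → T (inOrbit rot d e) → T (inOrbit rot (α d) (α e)) → d ≡ e

  Simple : Set
  Simple = NoLoops × NoMultiEdges

  -- embedded in the sphere: Euler's formula V - E + F = 2 (for connected maps)
  Spherical : Set
  Spherical = numVertices ℕ.+ numFaces ≡ numEdges ℕ.+ 2

  PlanarSimpleConnected : Set
  PlanarSimpleConnected = Connected × Simple × Spherical

  IsPrism : Set
  IsPrism = ∃[ N ] (numVertices ≡ 2 ℕ.* N)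
                 × (faceSizes ↭ (N ∷ N ∷ replicate N 4))
                 × (∀ d → faceVector d ↭ (4 ∷ 4 ∷ N ∷ []))

  IsAntiprism : Set
  IsAntiprism = ∃[ N ] (numVertices ≡ 2 ℕ.* N)
                     × (faceSizes ↭ (N ∷ N ∷ replicate (2 ℕ.* N) 3))
                     × (∀ d → faceVector d ↭ (3 ∷ 3 ∷ 3 ∷ N ∷ []))

  PlanarPCC : Set
  PlanarPCC = PlanarSimpleConnected
            × (∀ d → 0ℚ ℚ.< curvature d)
            × (∀ d → 3 ≤ deg d)
            × (IsPrism → Data.Empty.⊥)
            × (IsAntiprism → Data.Empty.⊥)
    where import Data.Empty

  -- V(σ) is not a set, σ the face of d: two distinct steps of the
  -- boundary walk start at the same vertex
  VNotSet : Fin n → Set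
  VNotSet d = ∃[ e ] ∃[ e′ ] T (inOrbit φ d e) × T (inOrbit φ d e′) × e ≢ e′
              × T (inOrbit rot e e′)

  -- E(σ) is not a set: both darts of some edge lie on the boundary walk
  ENotSet : Fin n → Set
  ENotSet d = ∃[ e ] T (inOrbit φ d e) × T (inOrbit φ d (α e))

module Submission where

-- Let e ≠ e′ be darts of the face σ at a common vertex v, with e′ = φʳ e, e = φᵏ⁻ʳ e′ and
-- k = |σ|. A boundary walk cannot return to its starting vertex within two steps (that
-- would need a loop, a double edge or a vertex of degree 1), so r, k − r ≥ 3 and k ≥ 6.
-- As v has two corners in σ and its other corners lie in faces of size ≥ 3, K(v) > 0
-- gives deg v < 2 + ⌈12/k⌉. With deg v ≥ 3 this forces k ≤ 11, and k = 6 forces deg v = 3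
-- and r = 3; then e′ is rot e or rot² e, so φ³ e = rot e or φ³ e′ = rot e′, which again
-- produces a loop. If σ traverses both darts of an edge {x, α x}, then α x and
-- φ x = rot (α x) are distinct darts of σ at one vertex.

open import Defs
open import Data.Nat using (_≤_)
open import Data.Product using (_×_)
open import Data.Sum using (_⊎_)
open import Data.Fin using (Fin)

open import Function using (_∘_; id)
open import Data.Bool using (false; T; not)
open import Data.Empty using (⊥)
open import Data.Fin using (toℕ; fromℕ<; _≟_)
import Data.Fin.Properties as Finₚ
open import Data.Nat using (ℕ; zero; suc; _+_; _*_; _∸_; _<_; z≤n; s≤s)
open import Data.Nat.DivMod using (_%_; _/_; m%n<n; m≡m%n+[m/n]*n; m<n*o⇒m/o<n)
open import Data.Nat.ListAction using (sum)
open import Data.Nat.ListAction.Properties using (sum-↭)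
open import Data.Nat.Properties hiding (_≟_)
open import Data.Integer as ℤ using (ℤ; +_; +≤+)
import Data.Integer.Properties as ℤₚ
open import Data.Rational as ℚ using (0ℚ; 1ℚ)
import Data.Rational.Properties as ℚₚ
open import Data.Rational.Unnormalised as ℚᵘ using (mkℚᵘ; *≤*; *<*; *≡*)
import Data.Rational.Unnormalised.Properties as ℚᵘₚ
open import Data.List using (List; []; _∷_; _++_; map; length; tabulate; foldr; allFin)
open import Data.List.Properties using (length-tabulate; map-∘)
open import Data.List.Membership.Propositional using (_∈_; lose)
open import Data.List.Membership.Propositional.Properties
  using (∈-∃++; ∈-upTo⁺; ∈-allFin; ∈-filter⁺; ∈-filter⁻; ∈-tabulate⁺; ∈-tabulate⁻)
open import Data.List.Relation.Binary.Permutation.Propositional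
  using (_↭_; prep; ↭-trans)
open import Data.List.Relation.Binary.Permutation.Propositional.Properties
  using (shift; ∈-resp-↭; ↭-length)
  renaming (map⁺ to ↭-map⁺)
open import Data.List.Relation.Binary.Subset.Propositional using (_⊆_)
open import Data.List.Relation.Unary.All as All using ()
open import Data.List.Relation.Unary.AllPairs using ([]; _∷_)
open import Data.List.Relation.Unary.Any using (here; there; tail; satisfied)
open import Data.List.Relation.Unary.Any.Properties using (any⁺; any⁻)
  renaming (map⁺ to Any-map⁺; map⁻ to Any-map⁻)
open import Data.List.Relation.Unary.Unique.Propositional using (Unique)
import Data.List.Relation.Unary.Unique.Propositional.Properties as Uniqueₚ
open import Data.Product using (∃-syntax; _,_; proj₁; proj₂)
open import Data.Sum using ([_,_])
open import Relation.Binary.Definitions using (tri<; tri≈; tri>)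
open import Relation.Binary.PropositionalEquality
  using (_≡_; _≢_; refl; sym; trans; cong; cong₂; subst; subst₂; module ≡-Reasoning)
open import Relation.Nullary using (¬_; yes; no; contradiction)
open import Relation.Nullary.Decidable using (T?; toWitness; fromWitness)

T-not⇒¬T : ∀ {b} → T (not b) → ¬ T b
T-not⇒¬T {false} _ ()

module _ {A : Set} where

  ∈⇒↭∷ : ∀ {x : A} {xs} → x ∈ xs → ∃[ ys ] xs ↭ x ∷ ys
  ∈⇒↭∷ x∈xs with ys , zs , refl ← ∈-∃++ x∈xs = ys ++ zs , shift _ ys zs

  ∈-≢⇒↭∷∷ : ∀ {x y : A} {xs} → x ∈ xs → y ∈ xs → x ≢ y →
            ∃[ zs ] xs ↭ x ∷ y ∷ zs
  ∈-≢⇒↭∷∷ {x} x∈xs y∈xs x≢y =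
    let ys , xs↭x∷ys = ∈⇒↭∷ x∈xs
        zs , ys↭y∷zs = ∈⇒↭∷ (tail (x≢y ∘ sym) (∈-resp-↭ xs↭x∷ys y∈xs))
    in zs , ↭-trans xs↭x∷ys (prep x ys↭y∷zs)

  Unique⇒length≤ : ∀ {xs ys : List A} → Unique xs → xs ⊆ ys → length xs ≤ length ys
  Unique⇒length≤ [] _ = z≤n
  Unique⇒length≤ {x ∷ xs} {ys} (x∉xs ∷ xs-unique) x∷xs⊆ys
    with zs , ys↭x∷zs ← ∈⇒↭∷ (x∷xs⊆ys (here refl)) = begin
      suc (length xs)  ≤⟨ s≤s (Unique⇒length≤ xs-unique xs⊆zs) ⟩
      suc (length zs)  ≡⟨ ↭-length ys↭x∷zs ⟨
      length ys        ∎
    where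
      open ≤-Reasoning
      xs⊆zs : xs ⊆ zs
      xs⊆zs z∈xs =
        tail (All.lookup x∉xs z∈xs ∘ sym) (∈-resp-↭ ys↭x∷zs (x∷xs⊆ys (there z∈xs)))

sum-map-≤ : ∀ {A : Set} {f : A → ℕ} {c} → (∀ x → f x ≤ c) →
            ∀ xs → sum (map f xs) ≤ c * length xs
sum-map-≤ f≤c [] = z≤n
sum-map-≤ {f = f} {c} f≤c (x ∷ xs) = subst (sum (map f (x ∷ xs)) ≤_) (sym (*-suc c (length xs)))
  (+-mono-≤ (f≤c x) (sum-map-≤ f≤c xs))

-- ⌈ 12 / s ⌉: the bound 1/s ≤ weight s / 12 turns K(v) > 0 into an inequality on ℕ.
weight : ℕ → ℕ
weight zero       = 0
weight s@(suc _)  = (11 + s) / s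

12≤weight*s : ∀ k → 12 ≤ weight (suc k) * suc k
12≤weight*s k = +-cancelˡ-< s 11 (q * s) (begin-strict
    s + 11                ≡⟨ +-comm s 11 ⟩
    11 + s                ≡⟨ m≡m%n+[m/n]*n (11 + s) s ⟩
    (11 + s) % s + q * s  <⟨ +-monoˡ-< (q * s) (m%n<n (11 + s) s) ⟩
    s + q * s             ∎)
  where
    open ≤-Reasoning
    s = suc k
    q = weight s

weight≤ : ∀ s {c} → 12 ≤ c * s → weight s ≤ c
weight≤ zero              _     = z≤n
weight≤ s@(suc _) {c} 12≤cs =
  ≤-pred (m<n*o⇒m/o<n (subst (_< s + c * s) (+-comm s 11) (+-monoʳ-< s 12≤cs)))

toℚᵘ-/ : ∀ a b → ℚᵘ._≃_ (ℚ.toℚᵘ (+ a ℚ./ suc b)) (mkℚᵘ (+ a) b)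
toℚᵘ-/ a b = ℚₚ.toℚᵘ-fromℚᵘ (mkℚᵘ (+ a) b)

recip≤weight/12 : ∀ (M : Map) s → recip M s ℚ.≤ + weight s ℚ./ 12
recip≤weight/12 M zero    = ℚₚ.toℚᵘ-cancel-≤ (*≤* (+≤+ z≤n))
recip≤weight/12 M (suc k) = ℚₚ.toℚᵘ-cancel-≤
  (ℚᵘₚ.≤-respʳ-≃ (ℚᵘₚ.≃-sym (toℚᵘ-/ (weight (suc k)) 11))
    (ℚᵘₚ.≤-respˡ-≃ (ℚᵘₚ.≃-sym (toℚᵘ-/ 1 k))
      (*≤* (subst₂ ℤ._≤_ (sym (ℤₚ.pos-* 1 12)) (ℤₚ.pos-* (weight (suc k)) (suc k))
                       (+≤+ (12≤weight*s k))))))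

twelfths-+ : ∀ a b → (+ a ℚ./ 12) ℚ.+ (+ b ℚ./ 12) ≡ + (a + b) ℚ./ 12
twelfths-+ a b = ℚₚ.toℚᵘ-injective
  (ℚᵘₚ.≃-trans (ℚₚ.toℚᵘ-homo-+ (+ a ℚ./ 12) (+ b ℚ./ 12))
  (ℚᵘₚ.≃-trans (ℚᵘₚ.+-cong (toℚᵘ-/ a 11) (toℚᵘ-/ b 11))
  (ℚᵘₚ.≃-trans (*≡* cross-multiplied) (ℚᵘₚ.≃-sym (toℚᵘ-/ (a + b) 11)))))
  where
    open import Data.Integer.Tactic.RingSolver using (solve-∀)
    identity : ∀ (A B : ℤ) → (A ℤ.* + 12 ℤ.+ B ℤ.* + 12) ℤ.* + 12 ≡ (A ℤ.+ B) ℤ.* + 144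
    identity = solve-∀
    cross-multiplied : (+ a ℤ.* + 12 ℤ.+ + b ℤ.* + 12) ℤ.* + 12 ≡ + (a + b) ℤ.* + 144
    cross-multiplied = trans (identity (+ a) (+ b)) (cong (ℤ._* + 144) (sym (ℤₚ.pos-+ a b)))

sum-recip≤ : ∀ (M : Map) ss →
             foldr ℚ._+_ 0ℚ (map (recip M) ss) ℚ.≤ + sum (map weight ss) ℚ./ 12
sum-recip≤ M []       = ℚₚ.≤-refl
sum-recip≤ M (s ∷ ss) =
  subst (recip M s ℚ.+ foldr ℚ._+_ 0ℚ (map (recip M) ss) ℚ.≤_)
        (twelfths-+ (weight s) (sum (map weight ss)))
        (ℚₚ.+-mono-≤ (recip≤weight/12 M s) (sum-recip≤ M ss))

positive-curvature⇒ : ∀ d {W q} → 0ℚ ℚ.< (1ℚ ℚ.- + d ℚ./ 2) ℚ.+ q → q ℚ.≤ + W ℚ./ 12 →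
                      6 * d < 12 + W
positive-curvature⇒ d {W} {q} 0<K q≤W/12 =
  *-cancelˡ-< 2 (6 * d) (12 + W) (subst₂ _<_ (12d≡2*6d d) (2W+24≡2*[12+W] W) 12d<2W+24)
  where
    open import Data.Integer.Tactic.RingSolver using (solve-∀)
    open import Data.Nat.Tactic.RingSolver renaming (solve-∀ to solve-∀ℕ)
    0<K′ : 0ℚ ℚ.< (1ℚ ℚ.- + d ℚ./ 2) ℚ.+ (+ W ℚ./ 12)
    0<K′ = ℚₚ.<-≤-trans 0<K (ℚₚ.+-monoʳ-≤ (1ℚ ℚ.- + d ℚ./ 2) q≤W/12)
    K′ᵘ : ℚᵘ._≃_ (ℚ.toℚᵘ ((1ℚ ℚ.- + d ℚ./ 2) ℚ.+ (+ W ℚ./ 12)))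
                 ((mkℚᵘ (+ 1) 0 ℚᵘ.+ ℚᵘ.- mkℚᵘ (+ d) 1) ℚᵘ.+ mkℚᵘ (+ W) 11)
    K′ᵘ = ℚᵘₚ.≃-trans (ℚₚ.toℚᵘ-homo-+ (1ℚ ℚ.- + d ℚ./ 2) (+ W ℚ./ 12))
            (ℚᵘₚ.+-cong (ℚᵘₚ.≃-trans (ℚₚ.toℚᵘ-homo-+ 1ℚ (ℚ.- (+ d ℚ./ 2)))
                (ℚᵘₚ.+-cong (ℚᵘₚ.≃-refl {mkℚᵘ (+ 1) 0})
                   (ℚᵘₚ.≃-trans (ℚₚ.toℚᵘ-homo‿- (+ d ℚ./ 2)) (ℚᵘₚ.-‿cong (toℚᵘ-/ d 1)))))
              (toℚᵘ-/ W 11))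
    numerator>0 : + 0 ℤ.< ((+ 1 ℤ.* + 2 ℤ.+ ℤ.- + d ℤ.* + 1) ℤ.* + 12 ℤ.+ + W ℤ.* + 2) ℤ.* + 1
    numerator>0 with ℚᵘₚ.<-respʳ-≃ K′ᵘ (ℚₚ.toℚᵘ-mono-< 0<K′)
    ... | *<* 0<n = 0<n
    numerator+12D : ∀ (D V : ℤ) →
      ((+ 1 ℤ.* + 2 ℤ.+ ℤ.- D ℤ.* + 1) ℤ.* + 12 ℤ.+ V ℤ.* + 2) ℤ.* + 1 ℤ.+ D ℤ.* + 12
        ≡ V ℤ.* + 2 ℤ.+ + 24
    numerator+12D = solve-∀
    12d<2W+24 : d * 12 < W * 2 + 24
    12d<2W+24 = ℤₚ.drop‿+<+ (subst₂ ℤ._<_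
      (trans (ℤₚ.+-identityˡ _) (sym (ℤₚ.pos-* d 12)))
      (trans (numerator+12D (+ d) (+ W))
             (trans (cong (ℤ._+ + 24) (sym (ℤₚ.pos-* W 2))) (sym (ℤₚ.pos-+ (W * 2) 24))))
      (ℤₚ.+-monoˡ-< (+ d ℤ.* + 12) numerator>0))
    12d≡2*6d : ∀ d → d * 12 ≡ 2 * (6 * d)
    12d≡2*6d = solve-∀ℕ
    2W+24≡2*[12+W] : ∀ W → W * 2 + 24 ≡ 2 * (12 + W)
    2W+24≡2*[12+W] = solve-∀ℕ

module Orbit (M : Map) (p p⁻¹ : Fin (Map.n M) → Fin (Map.n M))
             (p⁻¹∘p : ∀ x → p⁻¹ (p x) ≡ x) where

  open Map M using (n)

  iterate : ℕ → Fin n → Fin n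
  iterate = iter M p

  p-injective : ∀ {x y} → p x ≡ p y → x ≡ y
  p-injective {x} {y} eq = trans (sym (p⁻¹∘p x)) (trans (cong p⁻¹ eq) (p⁻¹∘p y))

  iterate-injective : ∀ k {x y} → iterate k x ≡ iterate k y → x ≡ y
  iterate-injective zero    eq = eq
  iterate-injective (suc k) eq = iterate-injective k (p-injective eq)

  iterate-+ : ∀ a b x → iterate (a + b) x ≡ iterate a (iterate b x)
  iterate-+ zero    b x = refl
  iterate-+ (suc a) b x = cong p (iterate-+ a b x)

  iterate-∸ : ∀ {i j x} → i ≤ j → iterate i x ≡ iterate j x → iterate (j ∸ i) x ≡ x
  iterate-∸ {i} {j} {x} i≤j eq = sym (iterate-injective i (begin
    iterate i x                    ≡⟨ eq ⟩
    iterate j x                    ≡⟨ cong (λ k → iterate k x) (m+[n∸m]≡n i≤j) ⟨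
    iterate (i + (j ∸ i)) x        ≡⟨ iterate-+ i (j ∸ i) x ⟩
    iterate i (iterate (j ∸ i) x)  ∎))
    where open ≡-Reasoning

  period : ∀ x → ∃[ m ] iterate (suc m) x ≡ x × suc m ≤ n
  period x with i , j , i<j , eq ← Finₚ.pigeonhole (n<1+n n) (λ i → iterate (toℕ i) x) =
    toℕ j ∸ suc (toℕ i) ,
    subst (λ k → iterate k x ≡ x) j∸i≡suc (iterate-∸ (<⇒≤ i<j) eq) ,
    subst (_≤ n) j∸i≡suc (≤-trans (m∸n≤m (toℕ j) (toℕ i)) (≤-pred (Finₚ.toℕ<n j)))
    where j∸i≡suc = +-∸-assoc 1 i<j

  iterate-*-period : ∀ {x m} → iterate m x ≡ x → ∀ c → iterate (c * m) x ≡ x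
  iterate-*-period           per zero    = refl
  iterate-*-period {x} {m}  per (suc c) =
    trans (iterate-+ m (c * m) x) (trans (cong (iterate m) (iterate-*-period per c)) per)

  iterate-%-period : ∀ {x m} → iterate (suc m) x ≡ x →
                     ∀ k → iterate k x ≡ iterate (k % suc m) x
  iterate-%-period {x} {m} per k = begin
    iterate k x                    ≡⟨ cong (λ t → iterate t x) (m≡m%n+[m/n]*n k (suc m)) ⟩
    iterate (r + q * suc m) x      ≡⟨ iterate-+ r (q * suc m) x ⟩
    iterate r (iterate (q * suc m) x)  ≡⟨ cong (iterate r) (iterate-*-period per q) ⟩
    iterate r x                    ∎
    where
      open ≡-Reasoning
      r = k % suc m
      q = k / suc m

  infix 4 _∼_

  _∼_ : Fin n → Fin n → Set
  x ∼ y = ∃[ k ] iterate k x ≡ y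

  ∼-refl : ∀ {x} → x ∼ x
  ∼-refl = 0 , refl

  ∼-trans : ∀ {x y z} → x ∼ y → y ∼ z → x ∼ z
  ∼-trans {x} (a , refl) (b , refl) = b + a , iterate-+ b a x

  ∼-sym : ∀ {x y} → x ∼ y → y ∼ x
  ∼-sym {x} (k , refl) with m , per , _ ← period x = k * m , (begin
    iterate (k * m) (iterate k x)  ≡⟨ iterate-+ (k * m) k x ⟨
    iterate (k * m + k) x          ≡⟨ cong (λ t → iterate t x) k*m+k≡k*[1+m] ⟩
    iterate (k * suc m) x          ≡⟨ iterate-*-period per k ⟩
    x                              ∎)
    where
      open ≡-Reasoning
      k*m+k≡k*[1+m] = trans (+-comm (k * m) k) (sym (*-suc k m))

  ∼-step : ∀ {x y} → x ∼ y → x ∼ p y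
  ∼-step (k , eq) = suc k , cong p eq

  ∼-reduce : ∀ {x y m} → iterate (suc m) x ≡ x → (x∼y : x ∼ y) →
             iterate (proj₁ x∼y % suc m) x ≡ y
  ∼-reduce per (k , refl) = sym (iterate-%-period per k)

  inOrbit⇒∼ : ∀ {x y} → T (inOrbit M p x y) → x ∼ y
  inOrbit⇒∼ {x} {y} t
    with k , t′ ← satisfied (Any-map⁻ {f = λ k → iterate k x} (any⁻ _ (orbit M p x) t)) =
    k , toWitness t′

  ∼⇒inOrbit : ∀ {x y} → x ∼ y → T (inOrbit M p x y)
  ∼⇒inOrbit {x} x∼y with m , per , m<n ← period x =
    any⁺ _ (Any-map⁺ (lose (∈-upTo⁺ (<-≤-trans (m%n<n (proj₁ x∼y) (suc m)) m<n))
                           (fromWitness (∼-reduce per x∼y))))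

  ∼⇒∈orbitSet : ∀ {x y} → x ∼ y → y ∈ orbitSet M p x
  ∼⇒∈orbitSet {x} x∼y = ∈-filter⁺ (T? ∘ inOrbit M p x) (∈-allFin _) (∼⇒inOrbit x∼y)

  ∈orbitSet⇒∼ : ∀ {x y} → y ∈ orbitSet M p x → x ∼ y
  ∈orbitSet⇒∼ {x} y∈ =
    inOrbit⇒∼ (proj₂ (∈-filter⁻ (T? ∘ inOrbit M p x) {xs = allFin n} y∈))

  orbitSet-Unique : ∀ x → Unique (orbitSet M p x)
  orbitSet-Unique x = Uniqueₚ.filter⁺ (T? ∘ inOrbit M p x) (Uniqueₚ.allFin⁺ n)

  orbitSize-cong : ∀ {x y} → x ∼ y → orbitSize M p x ≡ orbitSize M p y
  orbitSize-cong x∼y = ≤-antisym (orbitSize-mono x∼y) (orbitSize-mono (∼-sym x∼y))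
    where
      orbitSize-mono : ∀ {x y} → x ∼ y → orbitSize M p x ≤ orbitSize M p y
      orbitSize-mono x∼y = Unique⇒length≤ (orbitSet-Unique _)
        (λ z∈ → ∼⇒∈orbitSet (∼-trans (∼-sym x∼y) (∈orbitSet⇒∼ z∈)))

  ≤orbitSize : ∀ {x} k → (∀ j → 0 < j → j < k → iterate j x ≢ x) → k ≤ orbitSize M p x
  ≤orbitSize {x} k no-return =
    subst (_≤ orbitSize M p x) (length-tabulate f)
          (Unique⇒length≤ (Uniqueₚ.tabulate⁺ f-injective) f⊆orbit)
    where
      f : Fin k → Fin n
      f i = iterate (toℕ i) x
      distinct : ∀ {i j} → i < j → j < k → iterate i x ≢ iterate j x
      distinct {i} {j} i<j j<k eq = no-return (j ∸ i) (m<n⇒0<n∸m i<j)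
        (≤-<-trans (m∸n≤m j i) j<k) (iterate-∸ (<⇒≤ i<j) eq)
      f-injective : ∀ {i j} → f i ≡ f j → i ≡ j
      f-injective {i} {j} eq with <-cmp (toℕ i) (toℕ j)
      ... | tri< i<j _ _ = contradiction eq (distinct i<j (Finₚ.toℕ<n j))
      ... | tri≈ _ i≡j _ = Finₚ.toℕ-injective i≡j
      ... | tri> _ _ j<i = contradiction (sym eq) (distinct j<i (Finₚ.toℕ<n i))
      f⊆orbit : ∀ {y} → y ∈ tabulate f → y ∈ orbitSet M p x
      f⊆orbit y∈ with i , refl ← ∈-tabulate⁻ y∈ = ∼⇒∈orbitSet (toℕ i , refl)

  orbitSize≤period : ∀ {x m} → iterate (suc m) x ≡ x → orbitSize M p x ≤ suc m
  orbitSize≤period {x} {m} per =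
    subst (orbitSize M p x ≤_) (length-tabulate f)
          (Unique⇒length≤ (orbitSet-Unique x) orbit⊆f)
    where
      f : Fin (suc m) → Fin n
      f i = iterate (toℕ i) x
      orbit⊆f : ∀ {y} → y ∈ orbitSet M p x → y ∈ tabulate f
      orbit⊆f {y} y∈ with x∼y ← ∈orbitSet⇒∼ y∈ =
        subst (_∈ tabulate f) fr≡y (∈-tabulate⁺ {f = f} r)
        where
          r<1+m = m%n<n (proj₁ x∼y) (suc m)
          r : Fin (suc m)
          r = fromℕ< r<1+m
          fr≡y : f r ≡ y
          fr≡y = trans (cong (λ t → iterate t x) (Finₚ.toℕ-fromℕ< r<1+m)) (∼-reduce per x∼y)

module SimpleMap (M : Map) (simple : Simple M) (deg≥3 : ∀ d → 3 ≤ deg M d) where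

  open Map M

  module V = Orbit M rot rot⁻¹ rot-inv₂
  module F = Orbit M (φ M) (λ x → α (rot⁻¹ x))
                   (λ x → trans (cong α (rot-inv₂ (α x))) (α-invol x))

  rot-nofix : ∀ x → rot x ≢ x
  rot-nofix x rotx≡x =
    contradiction (≤-trans (deg≥3 x) (V.orbitSize≤period {m = 0} rotx≡x)) λ { (s≤s ()) }

  rot²-nofix : ∀ x → rot (rot x) ≢ x
  rot²-nofix x rot²x≡x =
    contradiction (≤-trans (deg≥3 x) (V.orbitSize≤period {m = 1} rot²x≡x)) λ { (s≤s (s≤s ())) }

  ¬sameVertex-α : ∀ x → ¬ x V.∼ α x
  ¬sameVertex-α x x∼αx = T-not⇒¬T (proj₁ simple x) (V.∼⇒inOrbit x∼αx)

  ¬sameVertex-φ : ∀ x → ¬ x V.∼ φ M x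
  ¬sameVertex-φ x x∼φx = ¬sameVertex-α x (V.∼-trans x∼φx (V.∼-sym (1 , refl)))

  -- Otherwise the edges of x and φ x both join the vertices of x and α x, so simplicity
  -- forces φ x = α x, a fixed point of rot.
  ¬sameVertex-φ² : ∀ x → ¬ x V.∼ φ M (φ M x)
  ¬sameVertex-φ² x x∼φ²x = rot-nofix (α x) (sym αx≡φx)
    where
      αx≡φx : α x ≡ φ M x
      αx≡φx = proj₂ simple (α x) (φ M x) (V.∼⇒inOrbit (1 , refl))
        (subst (λ y → T (inOrbit M rot y (α (φ M x)))) (sym (α-invol x))
               (V.∼⇒inOrbit (V.∼-trans x∼φ²x (V.∼-sym (1 , refl)))))

  -- Otherwise φ² x = α x, and then φ x and α (φ x) both lie at the vertex of α x.
  φ³≢rot : ∀ x → F.iterate 3 x ≢ rot x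
  φ³≢rot x φ³x≡rotx =
    ¬sameVertex-α (φ M x) (V.∼-trans (V.∼-sym (1 , refl)) (V.∼-sym (1 , φ²x≡αx)))
    where
      φ²x≡αx : φ M (φ M x) ≡ α x
      φ²x≡αx = trans (sym (α-invol _)) (cong α (V.p-injective φ³x≡rotx))

  sameVertex-after-≥3 : ∀ {x} j → F.iterate j x ≢ x → x V.∼ F.iterate j x → 3 ≤ j
  sameVertex-after-≥3 zero                      φ⁰x≢x _  = contradiction refl φ⁰x≢x
  sameVertex-after-≥3 {x} 1                     _     x∼ = contradiction x∼ (¬sameVertex-φ x)
  sameVertex-after-≥3 {x} 2                     _     x∼ = contradiction x∼ (¬sameVertex-φ² x)
  sameVertex-after-≥3     (suc (suc (suc j)))   _     _  = s≤s (s≤s (s≤s z≤n))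

  faceSize≥3 : ∀ x → 3 ≤ faceSize M x
  faceSize≥3 x = F.≤orbitSize 3 no-return
    where
      no-return : ∀ j → 0 < j → j < 3 → F.iterate j x ≢ x
      no-return 1 _ _ φx≡x  = ¬sameVertex-φ x (subst (x V.∼_) (sym φx≡x) V.∼-refl)
      no-return 2 _ _ φ²x≡x = ¬sameVertex-φ² x (subst (x V.∼_) (sym φ²x≡x) V.∼-refl)
      no-return (suc (suc (suc _))) _ (s≤s (s≤s (s≤s ())))

  rot³≡id : ∀ {x} → deg M x ≡ 3 → V.iterate 3 x ≡ x
  rot³≡id {x} deg≡3 with V.iterate 3 x ≟ x
  ... | yes rot³x≡x = rot³x≡x
  ... | no  rot³x≢x =
    contradiction (subst (4 ≤_) deg≡3 (V.≤orbitSize 4 no-return)) λ { (s≤s (s≤s (s≤s ()))) }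
    where
      no-return : ∀ j → 0 < j → j < 4 → V.iterate j x ≢ x
      no-return 1 _ _ = rot-nofix x
      no-return 2 _ _ = rot²-nofix x
      no-return 3 _ _ = rot³x≢x
      no-return (suc (suc (suc (suc _)))) _ (s≤s (s≤s (s≤s (s≤s ()))))

  ¬deg3-φ³-swap : ∀ {x y} → deg M x ≡ 3 → x ≢ y → x V.∼ y →
                  F.iterate 3 x ≡ y → F.iterate 3 y ≡ x → ⊥
  ¬deg3-φ³-swap {x} {y} deg≡3 x≢y x∼y φ³x≡y φ³y≡x =
    rot-steps (proj₁ x∼y % 3) (m%n<n (proj₁ x∼y) 3) (V.∼-reduce (rot³≡id deg≡3) x∼y)
    where
      rot-steps : ∀ b → b < 3 → V.iterate b x ≡ y → ⊥
      rot-steps 0 _ x≡y     = x≢y x≡y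
      rot-steps 1 _ rotx≡y  = φ³≢rot x (trans φ³x≡y (sym rotx≡y))
      rot-steps 2 _ rot²x≡y =
        φ³≢rot y (trans φ³y≡x (sym (trans (cong rot (sym rot²x≡y)) (rot³≡id deg≡3))))
      rot-steps (suc (suc (suc _))) (s≤s (s≤s (s≤s ()))) _

  ENotSet⇒VNotSet : ∀ {d} → ENotSet M d → VNotSet M d
  ENotSet⇒VNotSet (x , d∼x , d∼αx) =
    α x , φ M x , d∼αx , F.∼⇒inOrbit (F.∼-step (F.inOrbit⇒∼ d∼x)) ,
    (λ αx≡φx → rot-nofix (α x) (sym αx≡φx)) , V.∼⇒inOrbit (1 , refl)

gap-arithmetic : ∀ {k r} → r ≤ k → 3 ≤ r → 3 ≤ k ∸ r → k ≤ 6 → k ≡ 6 × r ≡ 3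
gap-arithmetic {k} {r} r≤k 3≤r 3≤k∸r k≤6 = k≡6 , ≤-antisym r≤3 3≤r
  where
    k∸r+r≡k : k ∸ r + r ≡ k
    k∸r+r≡k = m∸n+n≡m r≤k
    k≡6 : k ≡ 6
    k≡6 = ≤-antisym k≤6 (subst (6 ≤_) k∸r+r≡k (+-mono-≤ 3≤k∸r 3≤r))
    r≤3 : r ≤ 3
    r≤3 = +-cancelʳ-≤ 3 r 3 (≤-trans (+-monoʳ-≤ r 3≤k∸r)
            (subst (_≤ 6) (sym (trans (+-comm r (k ∸ r)) k∸r+r≡k)) k≤6))

two-corners-arithmetic : ∀ l w S → 6 * (2 + l) < 12 + (w + (w + S)) → S ≤ 4 * l → l < w
two-corners-arithmetic l w S 6[2+l]<12+2w+S S≤4l =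
  *-cancelˡ-< 2 l w (+-cancelˡ-< (12 + 4 * l) (2 * l) (2 * w) (subst₂ _<_ (lhs l) (rhs l w)
    (<-≤-trans 6[2+l]<12+2w+S (+-monoʳ-≤ 12 (+-monoʳ-≤ w (+-monoʳ-≤ w S≤4l))))))
  where
    open import Data.Nat.Tactic.RingSolver using (solve-∀)
    lhs : ∀ l → 6 * (2 + l) ≡ (12 + 4 * l) + 2 * l
    lhs = solve-∀
    rhs : ∀ l w → 12 + (w + (w + 4 * l)) ≡ (12 + 4 * l) + 2 * w
    rhs = solve-∀

module PositivelyCurved (M : Map) (simple : Simple M) (deg≥3 : ∀ d → 3 ≤ deg M d)
                        (K>0 : ∀ d → 0ℚ ℚ.< curvature M d) where

  open Map M
  open SimpleMap M simple deg≥3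

  -- K(v) > 0 where two corners of v have the same weight w and the other deg v − 2
  -- corners, lying in faces of size ≥ 3, have weight ≤ 4.
  deg<2+weight : ∀ {x y} → x ≢ y → x V.∼ y → faceSize M x ≡ faceSize M y →
                 deg M x < 2 + weight (faceSize M x)
  deg<2+weight {x} {y} x≢y x∼y fx≡fy
    with zs , corners↭ ← ∈-≢⇒↭∷∷ (V.∼⇒∈orbitSet V.∼-refl) (V.∼⇒∈orbitSet x∼y) x≢y =
    subst (_< 2 + w) (sym deg≡2+l) (+-monoʳ-< 2 (two-corners-arithmetic l w S
      (subst₂ (λ a b → 6 * a < 12 + b) deg≡2+l Σweight≡ 6deg<12+Σweight) S≤4l))
    where
      w = weight (faceSize M x)
      l = length zs
      S = sum (map (weight ∘ faceSize M) zs)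
      6deg<12+Σweight : 6 * deg M x < 12 + sum (map weight (faceVector M x))
      6deg<12+Σweight = positive-curvature⇒ (deg M x) (K>0 x) (sum-recip≤ M (faceVector M x))
      deg≡2+l : deg M x ≡ 2 + l
      deg≡2+l = ↭-length corners↭
      Σweight≡ : sum (map weight (faceVector M x)) ≡ w + (w + S)
      Σweight≡ = trans (sum-↭ (↭-map⁺ weight (↭-map⁺ (faceSize M) corners↭)))
        (cong₂ (λ a b → w + (weight a + b)) (sym fx≡fy) (cong sum (sym (map-∘ zs))))
      S≤4l : S ≤ 4 * l
      S≤4l = sum-map-≤ {c = 4} (λ z → weight≤ (faceSize M z) (*-monoʳ-≤ 4 (faceSize≥3 z))) zs

  module RepeatedVertex {e e′ : Fin n} (e∼e′ : e F.∼ e′) (e∼ᵥe′ : e V.∼ e′) (e≢e′ : e ≢ e′) where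

    short-period : ∀ m → suc m ≤ 6 → F.iterate (suc m) e ≡ e →
                   suc m ≡ 6 × F.iterate 3 e ≡ e′ × F.iterate 3 e′ ≡ e
    short-period m k≤6 per =
      k≡6 ,
      subst (λ t → F.iterate t e ≡ e′) r≡3 φʳe≡e′ ,
      subst (λ t → F.iterate t e′ ≡ e) (cong₂ _∸_ k≡6 r≡3) φᵏ⁻ʳe′≡e
      where
        k = suc m
        r = proj₁ e∼e′ % k
        r≤k : r ≤ k
        r≤k = <⇒≤ (m%n<n (proj₁ e∼e′) k)
        φʳe≡e′ : F.iterate r e ≡ e′
        φʳe≡e′ = F.∼-reduce per e∼e′
        φᵏ⁻ʳe′≡e : F.iterate (k ∸ r) e′ ≡ e
        φᵏ⁻ʳe′≡e = begin
          F.iterate (k ∸ r) e′                ≡⟨ cong (F.iterate (k ∸ r)) φʳe≡e′ ⟨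
          F.iterate (k ∸ r) (F.iterate r e)  ≡⟨ F.iterate-+ (k ∸ r) r e ⟨
          F.iterate (k ∸ r + r) e            ≡⟨ cong (λ t → F.iterate t e) (m∸n+n≡m r≤k) ⟩
          F.iterate k e                      ≡⟨ per ⟩
          e                                  ∎
          where open ≡-Reasoning
        3≤r : 3 ≤ r
        3≤r = sameVertex-after-≥3 r (λ eq → e≢e′ (trans (sym eq) φʳe≡e′))
                (subst (e V.∼_) (sym φʳe≡e′) e∼ᵥe′)
        3≤k∸r : 3 ≤ k ∸ r
        3≤k∸r = sameVertex-after-≥3 (k ∸ r) (λ eq → e≢e′ (trans (sym φᵏ⁻ʳe′≡e) eq))
                  (subst (e′ V.∼_) (sym φᵏ⁻ʳe′≡e) (V.∼-sym e∼ᵥe′))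
        k≡6 = proj₁ (gap-arithmetic r≤k 3≤r 3≤k∸r k≤6)
        r≡3 = proj₂ (gap-arithmetic r≤k 3≤r 3≤k∸r k≤6)

    faceSize≥6 : 6 ≤ faceSize M e
    faceSize≥6 = F.≤orbitSize 6 λ { (suc m) _ k<6 per →
      <-irrefl (proj₁ (short-period m (<⇒≤ k<6) per)) k<6 }

    ¬period6 : F.iterate 6 e ≢ e
    ¬period6 per = ¬deg3-φ³-swap deg≡3 e≢e′ e∼ᵥe′ φ³e≡e′ φ³e′≡e
      where
        φ³e≡e′ = proj₁ (proj₂ (short-period 5 ≤-refl per))
        φ³e′≡e = proj₂ (proj₂ (short-period 5 ≤-refl per))
        deg<4 : deg M e < 4
        deg<4 = <-≤-trans (deg<2+weight e≢e′ e∼ᵥe′ (F.orbitSize-cong e∼e′))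
                          (+-monoʳ-≤ 2 (weight≤ (faceSize M e) (*-monoʳ-≤ 2 faceSize≥6)))
        deg≡3 : deg M e ≡ 3
        deg≡3 = ≤-antisym (≤-pred deg<4) (deg≥3 e)

    faceSize≥7 : 7 ≤ faceSize M e
    faceSize≥7 = F.≤orbitSize 7 λ { (suc m) _ (s≤s m<6) per →
      ¬period6 (subst (λ t → F.iterate t e ≡ e) (proj₁ (short-period m m<6 per)) per) }

    faceSize≤11 : faceSize M e ≤ 11
    faceSize≤11 = ≮⇒≥ λ 11<s → <⇒≱
      (<-≤-trans (deg<2+weight e≢e′ e∼ᵥe′ (F.orbitSize-cong e∼e′))
                 (+-monoʳ-≤ 2 (weight≤ (faceSize M e) (subst (12 ≤_) (sym (*-identityˡ _)) 11<s))))
      (deg≥3 e)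

  VNotSet⇒7≤faceSize≤11 : ∀ {d} → VNotSet M d → 7 ≤ faceSize M d × faceSize M d ≤ 11
  VNotSet⇒7≤faceSize≤11 {d} (e , e′ , d∼e , d∼e′ , e≢e′ , e∼ᵥe′) =
    subst (7 ≤_) size≡ faceSize≥7 , subst (_≤ 11) size≡ faceSize≤11
    where
      e∼d : e F.∼ d
      e∼d = F.∼-sym (F.inOrbit⇒∼ d∼e)
      open RepeatedVertex (F.∼-trans e∼d (F.inOrbit⇒∼ d∼e′)) (V.inOrbit⇒∼ e∼ᵥe′) e≢e′
      size≡ : faceSize M e ≡ faceSize M d
      size≡ = F.orbitSize-cong e∼d

lemma2p2 : (M : Map) → PlanarPCC M → (d : Fin (Map.n M))
         → (VNotSet M d ⊎ ENotSet M d)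
         → (7 ≤ faceSize M d) × (faceSize M d ≤ 11)
lemma2p2 M ((_ , simple , _) , K>0 , deg≥3 , _) d repeated =
  VNotSet⇒7≤faceSize≤11 ([ id , ENotSet⇒VNotSet ] repeated)
  where
    open SimpleMap M simple deg≥3 using (ENotSet⇒VNotSet)
    open PositivelyCurved M simple deg≥3 K>0 using (VNotSet⇒7≤faceSize≤11)
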